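{- Let $S$ be a finite set of alternatives, $V=\{1,\dots,N\}$ a finite set of voters, and $f:\Pi_S^V\to\Pi_S$ a social welfare function satisfying Independence of Irrelevant Alternatives. Then $f$ is clerical-dictatorial.
   Context: $\Pi_S$ denotes the set of complete transitive binary relations (weak preferences) on $S$; for $R\in\Pi_S$ we write $x\le_R y$ for $(x,y)\in R$, and $x<_R y$, $x=_R y$ have the obvious meanings. A configuration is ${\bf R}=(R_1,\dots,R_N)\in\Pi_S^V$. A social welfare function (SWF) is any map $f:\Pi_S^V\to\Pi_S$ (for any finite voter set $V$, possibly empty). Independence of Irrelevant Alternatives (IIA): whenever ${\bf P},{\bf Q}\in\Pi_S^V$ agree (for every voter) on the pair $\{x,y\}$, $f({\bf P})$ and $f({\bf Q})$ agree on $\{x,y\}$. $f$ is null if $x=_{f({\bf R})}y$ for all ${\bf R}$ and all $x,y$. $f$ is dictatorial with dictator $i$ if either for all $x,y,{\bf R}$: $x\le_{f({\bf R})}y\Rightarrow x\le_{R_i}y$, or for all $x,y,{\bf R}$: $x\le_{f({\bf R})}y\Rightarrow y\le_{R_i}x$. For ${\bf R}\in\Pi_S^V$, ${\bf R}_{ -i}\in\Pi_S^{V\setminus\{i\}}$ is its restriction to voters other than $i$. A dictatorial $f$ with dictator $i$ defers to $g:\Pi_S^{V\setminus\{i\}}\to\Pi_S$ over $i$ if for all $x,y\in S$ and ${\bf R}$ with $x=_{R_i}y$: $x\le_{f({\bf R})}y\iff x\le_{g({\bf R}_{ -i})}y$. $f$ is clerical with cleric $C\in\Pi_S$ if for all $x,y,{\bf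 R}$: $x\le_{f({\bf R})}y\Rightarrow x\le_C y$. For $A\subseteq S$, the restriction $f|_A:\Pi_A^V\to\Pi_A$ is defined by: given ${\bf R}\in\Pi_A^V$ pick any ${\bf R}'\in\Pi_S^V$ agreeing with ${\bf R}$ on all pairs in $A$, and set $x\le_{f|_A({\bf R})}y$ iff $x\le_{f({\bf R}')}y$ for $x,y\in A$; $f|_A$ is well defined if this does not depend on the choice of ${\bf R}'$. Clerical-dictatorial (recursive definition): $f:\Pi_S^V\to\Pi_S$ is clerical-dictatorial if it is null, or $|S|\le 2$, or there is a cleric $C\in\Pi_S$ such that (1) $f$ is clerical with cleric $C$, and (2) for every equivalence class $A$ of $C$: (a) $f|_A$ is well defined and is null, dictatorial, or $|A|=2$; (b) if $f|_A$ is dictatorial (with dictator $j$) then it defers over $j$ to a clerical-dictatorial function $\Pi_A^{V\setminus\{j\}}\to\Pi_A$. -}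

module Defs where

open import Data.Bool using (Bool; true; false)
open import Data.Fin using (Fin)
open import Data.Nat using (ℕ)
open import Data.Product using (Σ; _×_; _,_; proj₁; proj₂)
open import Data.Sum using (_⊎_)
open import Relation.Binary.PropositionalEquality using (_≡_; _≢_)

-- A weak preference (element of Π_S): a Bool-valued relation, where
-- `rel x y ≡ true` means x ≤_R y; it must be complete and transitive.
record Pref (S : Set) : Set where
  field
    rel      : S → S → Bool
    complete : ∀ x y → rel x y ≡ true ⊎ rel y x ≡ true
    trans    : ∀ x y z → rel x y ≡ true → rel y z ≡ true → rel x z ≡ true
open Pref public

_≤⟨_⟩_ : {S : Set} → S → Pref S → S → Set
x ≤⟨ R ⟩ y = rel R x y ≡ true

_≈⟨_⟩_ : {S : Set} → S → Pref S → S → Set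
x ≈⟨ R ⟩ y = (x ≤⟨ R ⟩ y) × (y ≤⟨ R ⟩ x)

Config : Set → Set → Set
Config S V = V → Pref S

SWF : Set → Set → Set
SWF S V = Config S V → Pref S

AgreeOn : {S : Set} → Pref S → Pref S → S → S → Set
AgreeOn P Q x y = (rel P x y ≡ rel Q x y) × (rel P y x ≡ rel Q y x)

IIA : {S V : Set} → SWF S V → Set
IIA {S} {V} f = ∀ (P Q : Config S V) (x y : S) →
  (∀ i → AgreeOn (P i) (Q i) x y) → AgreeOn (f P) (f Q) x y

Null : {S V : Set} → SWF S V → Set
Null {S} {V} f = ∀ (R : Config S V) (x y : S) → x ≈⟨ f R ⟩ y

Dictator : {S V : Set} → SWF S V → V → Set
Dictator {S} {V} f i =
    (∀ (R : Config S V) (x y : S) → x ≤⟨ f R ⟩ y → x ≤⟨ R i ⟩ y)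
  ⊎ (∀ (R : Config S V) (x y : S) → x ≤⟨ f R ⟩ y → y ≤⟨ R i ⟩ x)

Dictatorial : {S V : Set} → SWF S V → Set
Dictatorial {S} {V} f = Σ V (Dictator f)

_∖_ : (V : Set) → V → Set
V ∖ i = Σ V (λ k → k ≢ i)

drop : {S V : Set} → Config S V → (i : V) → Config S (V ∖ i)
drop R i k = R (proj₁ k)

Defers : {S V : Set} → SWF S V → (i : V) → SWF S (V ∖ i) → Set
Defers {S} {V} f i g = ∀ (R : Config S V) (x y : S) → x ≈⟨ R i ⟩ y →
  rel (f R) x y ≡ rel (g (drop R i)) x y

Clerical : {S V : Set} → SWF S V → Pref S → Set
Clerical {S} {V} f C = ∀ (R : Config S V) (x y : S) → x ≤⟨ f R ⟩ y → x ≤⟨ C ⟩ y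

Class : {S : Set} → Pref S → S → Set
Class {S} C x = Σ S (λ y → x ≈⟨ C ⟩ y)

restrictPref : {S : Set} (P : S → Set) → Pref S → Pref (Σ S P)
restrictPref P R = record
  { rel      = λ a b → rel R (proj₁ a) (proj₁ b)
  ; complete = λ a b → complete R (proj₁ a) (proj₁ b)
  ; trans    = λ a b c → trans R (proj₁ a) (proj₁ b) (proj₁ c)
  }

-- f|_A is well defined and equals g, for A the C-class of x:
-- for every configuration R' on S, f(R') restricted to A is g(R' restricted to A).
RestrictsTo : {S V : Set} → SWF S V → (C : Pref S) → (x : S) → SWF (Class C x) V → Set
RestrictsTo {S} {V} f C x g = ∀ (R : Config S V) (a b : Class C x) →
  rel (f R) (proj₁ a) (proj₁ b) ≡ rel (g (λ i → restrictPref (λ y → x ≈⟨ C ⟩ y) (R i))) a b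

AtMostTwo : Set → Set
AtMostTwo S = ∀ (x y z : S) → x ≡ y ⊎ y ≡ z ⊎ x ≡ z

ExactlyTwo : Set → Set
ExactlyTwo A = Σ A (λ x → Σ A (λ y → x ≢ y × (∀ z → z ≡ x ⊎ z ≡ y)))

data ClericalDictatorial : (S V : Set) → SWF S V → Set₁ where
  cd-null  : ∀ {S V} {f : SWF S V} → Null f → ClericalDictatorial S V f
  cd-small : ∀ {S V} {f : SWF S V} → AtMostTwo S → ClericalDictatorial S V f
  cd-cleric : ∀ {S V} {f : SWF S V} (C : Pref S) →
    Clerical f C →
    (∀ (x : S) → Σ (SWF (Class C x) V) λ g →
        RestrictsTo f C x g
      × (Null g ⊎ Dictatorial g ⊎ ExactlyTwo (Class C x))
      × (∀ (j : V) → Dictator g j →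
           Σ (SWF (Class C x) (V ∖ j)) λ h →
             Defers g j h × ClericalDictatorial (Class C x) (V ∖ j) h)) →
    ClericalDictatorial S V f

-- The cleric ranks a weakly below b when some configuration makes f do so. By IIA only the
-- voters' comparisons of a and b matter, so this is decidable, and two witnessing
-- configurations can be merged voter by voter, so it is transitive; f is clerical for it by
-- construction. Inside a class of the cleric every comparison is attainable, so by Wilson's
-- theorem f restricted to the class is null or (inversely) dictatorial, unless the class has
-- two elements; Wilson's theorem reduces to Arrow's, proved by showing that the decisive
-- coalitions form an ultrafilter, which is principal as there are finitely many voters.
-- A dictator must sit on one of the finitely many seats f listens to, and the restriction
-- defers to the function obtained by seating an indifferent voter there. That function
-- listens to one seat fewer, so induction on the number of seats concludes.

module Submission where

open import Defs
open import Axiom.UniquenessOfIdentityProofs using (module Decidable⇒UIP)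
open import Data.Bool using (Bool; true; false; not; _∧_; if_then_else_; T)
import Data.Bool as Bool
open import Data.Bool.Properties using (T-≡; ⇔→≡)
open import Data.Empty using (⊥; ⊥-elim)
open import Data.Fin using (Fin; zero; suc; punchIn; punchOut)
open import Data.Fin.Properties using (any?; punchInᵢ≢i; punchOut-punchIn; punchIn-punchOut; punchOut-cong)
  renaming (_≟_ to _≟F_)
open import Data.Maybe using (Maybe; just; nothing; maybe′)
open import Data.Maybe.Properties using (just-injective)
open import Data.Nat using (ℕ; zero; suc; _≤ᵇ_)
open import Data.Nat.Properties using (≤ᵇ⇒≤; ≤⇒≤ᵇ; ≤-total; ≤-trans)
open import Data.Product using (Σ; ∃; _×_; _,_; proj₁; proj₂; swap; map₂)
open import Data.Product.Properties using (×-≡,≡→≡; ×-≡,≡←≡; ≡-dec)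
open import Data.Sum using (_⊎_; inj₁; inj₂)
import Data.Sum as Sum
open import Data.Unit.Polymorphic using (⊤; tt)
open import Function using (id; _∘_; const; Equivalence; mk⇔)
open import Relation.Binary.Definitions using (DecidableEquality)
open import Relation.Binary.PropositionalEquality
  using (_≡_; _≢_; refl; sym; cong; cong₂; subst; subst₂; ≢-sym; module ≡-Reasoning)
  renaming (trans to ≡-trans)
open import Relation.Nullary using (¬_; Dec; yes; no; does)
open import Relation.Nullary.Decidable using (dec-true; dec-false; ¬?; decidable-stable; map′; _⊎-dec_; _×-dec_)
open import Relation.Unary using (Decidable)

private
  variable
    S V : Set

true≢false : true ≢ false
true≢false ()

≡true : ∀ {b} → T b → b ≡ true
≡true = Equivalence.to T-≡

T-of : ∀ {b} → b ≡ true → T b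
T-of = Equivalence.from T-≡

_<⟨_⟩_ : S → Pref S → S → Set
x <⟨ R ⟩ y = rel R y x ≡ false

≤-refl : (R : Pref S) (x : S) → x ≤⟨ R ⟩ x
≤-refl R x = Sum.[ id , id ] (complete R x x)

<⇒≱ : (R : Pref S) {x y : S} → x <⟨ R ⟩ y → ¬ y ≤⟨ R ⟩ x
<⇒≱ R y≰x y≤x = true≢false (≡-trans (sym y≤x) y≰x)

<⇒≤ : (R : Pref S) {x y : S} → x <⟨ R ⟩ y → x ≤⟨ R ⟩ y
<⇒≤ R {x} {y} x<y = Sum.[ id , ⊥-elim ∘ <⇒≱ R x<y ] (complete R x y)

<-asym : (R : Pref S) {x y : S} → x <⟨ R ⟩ y → y <⟨ R ⟩ x → ⊥
<-asym R {x} {y} x<y y<x = Sum.[ <⇒≱ R y<x , <⇒≱ R x<y ] (complete R x y)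

≤-<-trans : (R : Pref S) {x y z : S} → x ≤⟨ R ⟩ y → y <⟨ R ⟩ z → x <⟨ R ⟩ z
≤-<-trans R {x} {y} {z} x≤y y<z with rel R z x in z≤x
... | false = refl
... | true  = ⊥-elim (<⇒≱ R y<z (trans R z x y z≤x x≤y))

<-trans : (R : Pref S) {x y z : S} → x <⟨ R ⟩ y → y <⟨ R ⟩ z → x <⟨ R ⟩ z
<-trans R x<y = ≤-<-trans R (<⇒≤ R x<y)

Comparison : Set
Comparison = Bool × Bool

comparison : Pref S → S → S → Comparison
comparison R x y = rel R x y , rel R y x

below above : Comparison
below = true , false
above = false , true

_≟C_ : DecidableEquality Comparison
_≟C_ = ≡-dec Bool._≟_ Bool._≟_

orient : Bool → Comparison
orient true = below
orient false = above

Valid : Comparison → Set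
Valid (u , v) = u ≡ true ⊎ v ≡ true

comparison-valid : (R : Pref S) (x y : S) → Valid (comparison R x y)
comparison-valid R x y = complete R x y

invalid : ¬ Valid (false , false)
invalid (inj₁ ())
invalid (inj₂ ())

comparison-below : (R : Pref S) {x y : S} → x <⟨ R ⟩ y → comparison R x y ≡ below
comparison-below R x<y = ×-≡,≡→≡ (<⇒≤ R x<y , x<y)

IIAOn : {S V W : Set} → (W → V) → SWF S V → Set
IIAOn listens f = ∀ P Q x y → (∀ w → AgreeOn (P (listens w)) (Q (listens w)) x y) → AgreeOn (f P) (f Q) x y

module Independence {S V W : Set} {listens : W → V} {f : SWF S V} (iia : IIAOn listens f)
  (P Q : Config S V) {x y : S}
  (same : ∀ w → comparison (P (listens w)) x y ≡ comparison (Q (listens w)) x y) where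

  iia-comparison : comparison (f P) x y ≡ comparison (f Q) x y
  iia-comparison = ×-≡,≡→≡ (iia P Q x y (λ i → ×-≡,≡←≡ (same i)))

  iia-≤ : x ≤⟨ f Q ⟩ y → x ≤⟨ f P ⟩ y
  iia-≤ = ≡-trans (cong proj₁ iia-comparison)

  iia-< : x <⟨ f Q ⟩ y → x <⟨ f P ⟩ y
  iia-< = ≡-trans (cong proj₂ iia-comparison)

ranks : ℕ → ℕ → Comparison
ranks i j = (i ≤ᵇ j) , (j ≤ᵇ i)

≤ᵇ-total : ∀ i j → (i ≤ᵇ j) ≡ true ⊎ (j ≤ᵇ i) ≡ true
≤ᵇ-total i j = Sum.map (≡true ∘ ≤⇒≤ᵇ) (≡true ∘ ≤⇒≤ᵇ) (≤-total i j)

≤ᵇ-trans : ∀ i j k → (i ≤ᵇ j) ≡ true → (j ≤ᵇ k) ≡ true → (i ≤ᵇ k) ≡ true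
≤ᵇ-trans i j k i≤j j≤k = ≡true (≤⇒≤ᵇ (≤-trans (≤ᵇ⇒≤ i j (T-of i≤j)) (≤ᵇ⇒≤ j k (T-of j≤k))))

byRank : (S → ℕ) → Pref S
byRank r = record
  { rel      = λ x y → r x ≤ᵇ r y
  ; complete = λ x y → ≤ᵇ-total (r x) (r y)
  ; trans    = λ x y z → ≤ᵇ-trans (r x) (r y) (r z)
  }

indifference : Pref S
indifference = byRank (const 0)

comap : {S T : Set} → (S → T) → Pref T → Pref S
comap π P = record
  { rel      = λ x y → rel P (π x) (π y)
  ; complete = λ x y → complete P (π x) (π y)
  ; trans    = λ x y z → trans P (π x) (π y) (π z)
  }

subsingleton-null : (∀ (x y : S) → x ≡ y) → (f : SWF S V) → Null f
subsingleton-null all-equal f R x y with all-equal x y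
... | refl = ≤-refl (f R) x , ≤-refl (f R) x

-- ranks 1, 2, 3 realise a valid comparison against the pivot rank 2
encode : Comparison → ℕ
encode (true  , false) = 1
encode (false , true)  = 3
encode _               = 2

ranks-encode : ∀ p → Valid p → ranks (encode p) 2 ≡ p
ranks-encode (true  , true)  _ = refl
ranks-encode (true  , false) _ = refl
ranks-encode (false , true)  _ = refl
ranks-encode (false , false) (inj₁ ())
ranks-encode (false , false) (inj₂ ())

ranks-0-encode : ∀ p → ranks 0 (encode p) ≡ below
ranks-0-encode (true  , true)  = refl
ranks-0-encode (true  , false) = refl
ranks-0-encode (false , true)  = refl
ranks-0-encode (false , false) = refl

ranks-encode-4 : ∀ p → ranks (encode p) 4 ≡ below
ranks-encode-4 (true  , true)  = refl
ranks-encode-4 (true  , false) = refl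
ranks-encode-4 (false , true)  = refl
ranks-encode-4 (false , false) = refl

module Ballots {A : Set} (_≟_ : DecidableEquality A) where

  pin : A → ℕ → (A → ℕ) → A → ℕ
  pin a i r s = if does (s ≟ a) then i else r s

  pin-here : ∀ a i r → pin a i r a ≡ i
  pin-here a i r rewrite dec-true (a ≟ a) refl = refl

  pin-there : ∀ {a s} i r → s ≢ a → pin a i r s ≡ r s
  pin-there {a} {s} i r s≢a rewrite dec-false (s ≟ a) s≢a = refl

  placed : A → Comparison → Pref A
  placed a p = byRank (pin a (encode p) (const 2))

  placed-comparison : ∀ {a b p} → a ≢ b → Valid p → comparison (placed a p) a b ≡ p
  placed-comparison {a} {b} {p} a≢b valid =
    ≡-trans (cong₂ ranks (pin-here a (encode p) (const 2)) (pin-there (encode p) (const 2) (≢-sym a≢b)))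
            (ranks-encode p valid)

  top : A → Pref A
  top b = placed b above

  top-below : ∀ {a b} → a ≢ b → comparison (top b) a b ≡ below
  top-below a≢b = cong swap (placed-comparison (≢-sym a≢b) (inj₂ refl))

  orientBallot : A → A → Bool → Pref A
  orientBallot a b g = top (if g then b else a)

  orientBallot-comparison : ∀ {a b} → a ≢ b → ∀ g → comparison (orientBallot a b g) a b ≡ orient g
  orientBallot-comparison a≢b true  = top-below a≢b
  orientBallot-comparison a≢b false = cong swap (top-below (≢-sym a≢b))

  module Triple {a b c : A} (a≢b : a ≢ b) (a≢c : a ≢ c) (b≢c : b ≢ c) where

    rank : ℕ → ℕ → ℕ → A → ℕ
    rank i j k = pin a i (pin b j (pin c k (const 0)))

    ranked : ℕ → ℕ → ℕ → Pref A
    ranked i j k = byRank (rank i j k)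

    rank-a : ∀ {i j k} → rank i j k a ≡ i
    rank-a {i} {j} {k} = pin-here a i (pin b j (pin c k (const 0)))

    rank-b : ∀ {i j k} → rank i j k b ≡ j
    rank-b {i} {j} {k} =
      ≡-trans (pin-there i (pin b j (pin c k (const 0))) (≢-sym a≢b)) (pin-here b j (pin c k (const 0)))

    rank-c : ∀ {i j k} → rank i j k c ≡ k
    rank-c {i} {j} {k} =
      ≡-trans (pin-there i (pin b j (pin c k (const 0))) (≢-sym a≢c))
        (≡-trans (pin-there j (pin c k (const 0)) (≢-sym b≢c)) (pin-here c k (const 0)))

    ranked-ab : ∀ {i j k} → comparison (ranked i j k) a b ≡ ranks i j
    ranked-ab = cong₂ ranks rank-a rank-b

    ranked-ac : ∀ {i j k} → comparison (ranked i j k) a c ≡ ranks i k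
    ranked-ac = cong₂ ranks rank-a rank-c

    ranked-bc : ∀ {i j k} → comparison (ranked i j k) b c ≡ ranks j k
    ranked-bc = cong₂ ranks rank-b rank-c

    ranked-ca : ∀ {i j k} → comparison (ranked i j k) c a ≡ ranks k i
    ranked-ca = cong swap ranked-ac

    ranked-cb : ∀ {i j k} → comparison (ranked i j k) c b ≡ ranks k j
    ranked-cb = cong swap ranked-bc

  -- c goes strictly between a and b exactly when a is strictly below b
  module Between {a b c : A} (a≢b : a ≢ b) (c≢a : c ≢ a) (c≢b : c ≢ b) where
    open Triple a≢b (≢-sym c≢a) (≢-sym c≢b)

    ballot : Comparison → Pref A
    ballot (true  , false) = ranked 0 2 1
    ballot (false , true)  = ranked 2 0 1
    ballot _               = ranked 2 2 1

    ac-below cb-below : Comparison → Bool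
    ac-below (true  , false) = true
    ac-below _               = false
    cb-below (false , true)  = false
    cb-below _               = true

    ballot-ab : ∀ p → Valid p → comparison (ballot p) a b ≡ p
    ballot-ab (true  , true)  _ = ranked-ab
    ballot-ab (true  , false) _ = ranked-ab
    ballot-ab (false , true)  _ = ranked-ab
    ballot-ab (false , false) (inj₁ ())
    ballot-ab (false , false) (inj₂ ())

    ballot-ac : ∀ p → comparison (ballot p) a c ≡ orient (ac-below p)
    ballot-ac (true  , true)  = ranked-ac
    ballot-ac (true  , false) = ranked-ac
    ballot-ac (false , true)  = ranked-ac
    ballot-ac (false , false) = ranked-ac

    ballot-cb : ∀ p → comparison (ballot p) c b ≡ orient (cb-below p)
    ballot-cb (true  , true)  = ranked-cb
    ballot-cb (true  , false) = ranked-cb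
    ballot-cb (false , true)  = ranked-cb
    ballot-cb (false , false) = ranked-cb

-- Coalitions

Coalition : ℕ → Set
Coalition m = Fin m → Bool

module _ {m : ℕ} where

  _⊆_ : Coalition m → Coalition m → Set
  Γ ⊆ Γ' = ∀ t → Γ t ≡ true → Γ' t ≡ true

  everyone nobody : Coalition m
  everyone _ = true
  nobody _ = false

  ⁅_⁆ : Fin m → Coalition m
  ⁅ t ⁆ s = does (s ≟F t)

  ∁ : Coalition m → Coalition m
  ∁ Γ t = not (Γ t)

  _∩_ : Coalition m → Coalition m → Coalition m
  (Γ ∩ H) t = Γ t ∧ H t

  ⁅⁆⊆ : ∀ {Γ t} → Γ t ≡ true → ⁅ t ⁆ ⊆ Γ
  ⁅⁆⊆ {t = t} Γt s s∈⁅t⁆ with s ≟F t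
  ... | yes refl = Γt

_◂_ : ∀ {m} → Bool → Coalition m → Coalition (suc m)
(g ◂ Γ) zero    = g
(g ◂ Γ) (suc t) = Γ t

principal : ∀ m (Δ : Coalition m → Set) →
  (∀ {Γ Γ'} → Γ ⊆ Γ' → Δ Γ → Δ Γ') →
  (∀ {Γ} H → Δ Γ → Δ (Γ ∩ H) ⊎ Δ (Γ ∩ ∁ H)) →
  Δ everyone → ¬ Δ nobody → ∃ λ t → Δ ⁅ t ⁆
principal zero Δ mono split Δ-everyone ¬Δ-nobody = ⊥-elim (¬Δ-nobody (mono (λ ()) Δ-everyone))
principal (suc m) Δ mono split Δ-everyone ¬Δ-nobody with split ⁅ zero ⁆ Δ-everyone
... | inj₁ Δ-first = zero , mono (λ _ p → p) Δ-first
... | inj₂ Δ-rest with principal m (Δ ∘ (false ◂_)) mono′ split′ Δ′-everyone ¬Δ′-nobody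
  where
  mono′ : ∀ {Γ Γ'} → Γ ⊆ Γ' → Δ (false ◂ Γ) → Δ (false ◂ Γ')
  mono′ Γ⊆Γ' = mono λ { zero () ; (suc t) → Γ⊆Γ' t }
  split′ : ∀ {Γ} H → Δ (false ◂ Γ) → Δ (false ◂ (Γ ∩ H)) ⊎ Δ (false ◂ (Γ ∩ ∁ H))
  split′ H Δ-Γ = Sum.map (mono λ { zero () ; (suc t) p → p }) (mono λ { zero () ; (suc t) p → p })
                         (split (false ◂ H) Δ-Γ)
  Δ′-everyone : Δ (false ◂ everyone)
  Δ′-everyone = mono (λ { zero () ; (suc t) _ → refl }) Δ-rest
  ¬Δ′-nobody : ¬ Δ (false ◂ nobody)
  ¬Δ′-nobody = ¬Δ-nobody ∘ mono λ { zero () ; (suc t) () }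
... | t , Δ-t = suc t , mono (λ { zero () ; (suc s) p → p }) Δ-t

∃-coalition? : ∀ m {P : Coalition m → Set} → (∀ {Γ Γ'} → (∀ t → Γ t ≡ Γ' t) → P Γ → P Γ') →
  (∀ Γ → Dec (P Γ)) → Dec (∃ P)
∃-coalition? zero {P} resp P? = map′ (nobody ,_) only (P? nobody)
  where
  only : ∃ P → P nobody
  only (Γ , p) = resp (λ ()) p
∃-coalition? (suc m) {P} resp P? =
  map′ Sum.[ extend true , extend false ] by-first-voter
       (∃-coalition? m (resp ∘ ◂-cong true) (P? ∘ (true ◂_)) ⊎-dec
        ∃-coalition? m (resp ∘ ◂-cong false) (P? ∘ (false ◂_)))
  where
  ◂-cong : ∀ g {Γ Γ' : Coalition m} → (∀ t → Γ t ≡ Γ' t) → ∀ t → (g ◂ Γ) t ≡ (g ◂ Γ') t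
  ◂-cong _ _    zero    = refl
  ◂-cong _ Γ≗Γ' (suc t) = Γ≗Γ' t
  extend : ∀ g → ∃ (P ∘ (g ◂_)) → ∃ P
  extend g (Γ , p) = g ◂ Γ , p
  by-first-voter : ∃ P → ∃ (P ∘ (true ◂_)) ⊎ ∃ (P ∘ (false ◂_))
  by-first-voter (Γ , p) with Γ zero in Γ₀
  ... | true  = inj₁ (Γ ∘ suc , resp (λ { zero → Γ₀ ; (suc t) → refl }) p)
  ... | false = inj₂ (Γ ∘ suc , resp (λ { zero → Γ₀ ; (suc t) → refl }) p)

∃-comparisons? : ∀ m {P : (Fin m → Comparison) → Set} → (∀ {q q'} → (∀ t → q t ≡ q' t) → P q → P q') →
  (∀ q → Dec (P q)) → Dec (∃ P)
∃-comparisons? m {P} resp P? =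
  map′ pair unpair (∃-coalition? m resp₁ λ u → ∃-coalition? m (resp₂ u) λ v → P? (u ⊗ v))
  where
  _⊗_ : Coalition m → Coalition m → Fin m → Comparison
  (u ⊗ v) t = u t , v t
  pair : ∃ (λ u → ∃ λ v → P (u ⊗ v)) → ∃ P
  pair (u , v , p) = u ⊗ v , p
  unpair : ∃ P → ∃ (λ u → ∃ λ v → P (u ⊗ v))
  unpair (q , p) = proj₁ ∘ q , proj₂ ∘ q , p
  resp₁ : ∀ {u u'} → (∀ t → u t ≡ u' t) → ∃ (λ v → P (u ⊗ v)) → ∃ (λ v → P (u' ⊗ v))
  resp₁ u≗u' (v , p) = v , resp (λ t → cong (_, v t) (u≗u' t)) p
  resp₂ : ∀ u {v v'} → (∀ t → v t ≡ v' t) → P (u ⊗ v) → P (u ⊗ v')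
  resp₂ u v≗v' = resp (λ t → cong (u t ,_) (v≗v' t))

-- Arrow's and Wilson's theorems

Third : Set → Set
Third A = (a b : A) → ∃ λ w → w ≢ a × w ≢ b

third : {A : Set} → DecidableEquality A → {x y z : A} → x ≢ y → x ≢ z → y ≢ z → Third A
third _≟_ {x} {y} {z} x≢y x≢z y≢z a b with x ≟ a | x ≟ b
... | no x≢a | no x≢b = x , x≢a , x≢b
... | yes refl | _ with y ≟ b
...   | no y≢b   = y , ≢-sym x≢y , y≢b
...   | yes refl = z , ≢-sym x≢z , ≢-sym y≢z
third _≟_ {x} {y} {z} x≢y x≢z y≢z a b | no x≢a | yes refl with y ≟ a
...   | no y≢a   = y , y≢a , ≢-sym x≢y
...   | yes refl = z , ≢-sym y≢z , ≢-sym x≢z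

module Transport {A : Set} (_≟_ : DecidableEquality A) (third : Third A) (Φ : A → A → Set)
  (changeʳ : ∀ {a b d} → a ≢ b → a ≢ d → b ≢ d → Φ a b → Φ a d)
  (changeˡ : ∀ {a b c} → a ≢ b → c ≢ a → c ≢ b → Φ a b → Φ c b) where

  moveʳ : ∀ {a b d} → a ≢ b → a ≢ d → Φ a b → Φ a d
  moveʳ {b = b} {d} a≢b a≢d φ with b ≟ d
  ... | yes refl = φ
  ... | no b≢d  = changeʳ a≢b a≢d b≢d φ

  moveˡ : ∀ {a b c} → a ≢ b → c ≢ b → Φ a b → Φ c b
  moveˡ {a} {c = c} a≢b c≢b φ with c ≟ a
  ... | yes refl = φ
  ... | no c≢a  = changeˡ a≢b c≢a c≢b φ

  transport : ∀ {a b c d} → a ≢ b → c ≢ d → Φ a b → Φ c d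
  transport {a} {b} {c} {d} a≢b c≢d φ with c ≟ b | d ≟ a
  ... | no c≢b   | _        = moveʳ c≢b c≢d (moveˡ a≢b c≢b φ)
  ... | yes refl | no d≢a   = moveˡ (≢-sym d≢a) c≢d (moveʳ a≢b (≢-sym d≢a) φ)
  ... | yes refl | yes refl with third a b
  ...   | w , w≢a , w≢b =
    moveʳ (≢-sym w≢b) (≢-sym a≢b) (moveˡ (≢-sym w≢a) (≢-sym w≢b) (moveʳ a≢b (≢-sym w≢a) φ))

strict⇒dictator : {S V : Set} → DecidableEquality S → (f : SWF S V) {t : V} →
  (∀ R {a b} → a ≢ b → a <⟨ R t ⟩ b → a <⟨ f R ⟩ b) → ∀ R a b → a ≤⟨ f R ⟩ b → a ≤⟨ R t ⟩ b
strict⇒dictator _≟_ f {t} strict R a b a≤b with a ≟ b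
... | yes refl = ≤-refl (R t) a
... | no a≢b with rel (R t) a b in b<a
...   | true  = refl
...   | false = ⊥-elim (<⇒≱ (f R) (strict R (≢-sym a≢b) b<a) a≤b)

module Arrow {A : Set} (_≟_ : DecidableEquality A) (third : Third A) {x y : A} (x≢y : x ≢ y)
  {m : ℕ} (G : SWF A (Fin m)) (iia : IIA G)
  (pareto : ∀ {a b} → a ≢ b → a <⟨ G (const (Ballots.top _≟_ b)) ⟩ b) where

  open Ballots _≟_
  open Transport _≟_ third
  open Independence {listens = id} {f = G} iia

  unanimity : ∀ {P a b} → a ≢ b → (∀ t → comparison (P t) a b ≡ below) → a <⟨ G P ⟩ b
  unanimity {P} {b = b} a≢b all-below =
    iia-< P (const (top b)) (λ t → ≡-trans (all-below t) (sym (top-below a≢b))) (pareto a≢b)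

  oriented : A → A → Coalition m → Config A (Fin m)
  oriented a b Γ t = orientBallot a b (Γ t)

  Decisive : A → A → Coalition m → Set
  Decisive a b Γ = a <⟨ G (oriented a b Γ) ⟩ b

  decisive⇒< : ∀ {P a b Γ} → a ≢ b → (∀ t → comparison (P t) a b ≡ orient (Γ t)) →
    Decisive a b Γ → a <⟨ G P ⟩ b
  decisive⇒< {P} {a} {b} {Γ} a≢b P≈Γ = iia-< P (oriented a b Γ) λ t →
    ≡-trans (P≈Γ t) (sym (orientBallot-comparison a≢b (Γ t)))

  <⇒decisive : ∀ {P a b Γ} → a ≢ b → (∀ t → comparison (P t) a b ≡ orient (Γ t)) →
    a <⟨ G P ⟩ b → Decisive a b Γ
  <⇒decisive {P} {a} {b} {Γ} a≢b P≈Γ = iia-< (oriented a b Γ) P λ t →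
    ≡-trans (orientBallot-comparison a≢b (Γ t)) (sym (P≈Γ t))

  decisive-changeʳ : ∀ {a b c Γ Γ'} → a ≢ b → a ≢ c → b ≢ c → Γ ⊆ Γ' → Decisive a b Γ → Decisive a c Γ'
  decisive-changeʳ {a} {b} {c} {Γ} {Γ'} a≢b a≢c b≢c Γ⊆Γ' a<b =
    <⇒decisive a≢c (λ t → ballot-ac (Γ t) (Γ' t) (Γ⊆Γ' t))
      (<-trans (G P) (decisive⇒< a≢b (λ t → ballot-ab (Γ t) (Γ' t)) a<b)
                     (unanimity b≢c (λ t → ballot-bc (Γ t) (Γ' t))))
    where
    open Triple a≢b a≢c b≢c
    ballot : Bool → Bool → Pref A
    ballot true  _     = ranked 0 1 2
    ballot false true  = ranked 1 0 2
    ballot false false = ranked 2 0 1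
    P : Config A (Fin m)
    P t = ballot (Γ t) (Γ' t)
    ballot-ab : ∀ g g' → comparison (ballot g g') a b ≡ orient g
    ballot-ab true  _     = ranked-ab
    ballot-ab false true  = ranked-ab
    ballot-ab false false = ranked-ab
    ballot-bc : ∀ g g' → comparison (ballot g g') b c ≡ below
    ballot-bc true  _     = ranked-bc
    ballot-bc false true  = ranked-bc
    ballot-bc false false = ranked-bc
    ballot-ac : ∀ g g' → (g ≡ true → g' ≡ true) → comparison (ballot g g') a c ≡ orient g'
    ballot-ac true  true  _ = ranked-ac
    ballot-ac true  false g⇒g' = ⊥-elim (true≢false (sym (g⇒g' refl)))
    ballot-ac false true  _ = ranked-ac
    ballot-ac false false _ = ranked-ac

  decisive-changeˡ : ∀ {a b c Γ} → a ≢ b → c ≢ a → c ≢ b → Decisive a b Γ → Decisive c b Γ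
  decisive-changeˡ {a} {b} {c} {Γ} a≢b c≢a c≢b a<b =
    <⇒decisive c≢b (λ t → ballot-cb (Γ t))
      (<-trans (G P) (unanimity c≢a (λ t → ballot-ca (Γ t)))
                     (decisive⇒< a≢b (λ t → ballot-ab (Γ t)) a<b))
    where
    open Triple a≢b (≢-sym c≢a) (≢-sym c≢b)
    ballot : Bool → Pref A
    ballot true  = ranked 1 2 0
    ballot false = ranked 2 0 1
    P : Config A (Fin m)
    P t = ballot (Γ t)
    ballot-ab : ∀ g → comparison (ballot g) a b ≡ orient g
    ballot-ab true  = ranked-ab
    ballot-ab false = ranked-ab
    ballot-ca : ∀ g → comparison (ballot g) c a ≡ below
    ballot-ca true  = ranked-ca
    ballot-ca false = ranked-ca
    ballot-cb : ∀ g → comparison (ballot g) c b ≡ orient g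
    ballot-cb true  = ranked-cb
    ballot-cb false = ranked-cb

  decisive-transport : ∀ {Γ a b c d} → a ≢ b → c ≢ d → Decisive a b Γ → Decisive c d Γ
  decisive-transport {Γ} = transport (λ a b → Decisive a b Γ)
    (λ a≢b a≢d b≢d → decisive-changeʳ a≢b a≢d b≢d (λ _ p → p)) decisive-changeˡ

  decisive-mono : ∀ {Γ Γ' a b} → a ≢ b → Γ ⊆ Γ' → Decisive a b Γ → Decisive a b Γ'
  decisive-mono {a = a} {b} a≢b Γ⊆Γ' a<b with third a b
  ... | w , w≢a , w≢b =
    decisive-changeʳ (≢-sym w≢a) a≢b w≢b (λ _ p → p)
      (decisive-changeʳ a≢b (≢-sym w≢a) (≢-sym w≢b) Γ⊆Γ' a<b)

  decisive-proper : ∀ {Γ a b} → a ≢ b → Decisive a b Γ → Decisive b a (∁ Γ) → ⊥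
  decisive-proper {Γ} {a} {b} a≢b a<b b<a =
    <-asym (G (oriented a b Γ)) a<b (iia-< _ _ (λ t → cong (λ R → comparison R b a) (flip (Γ t))) b<a)
    where
    flip : ∀ g → orientBallot a b g ≡ orientBallot b a (not g)
    flip true  = refl
    flip false = refl

  decisive-split : ∀ {Γ a b c} H → a ≢ b → a ≢ c → b ≢ c →
    Decisive a b Γ → Decisive a c (Γ ∩ H) ⊎ Decisive c b (Γ ∩ ∁ H)
  decisive-split {Γ} {a} {b} {c} H a≢b a≢c b≢c a<b = by-c≤a
    where
    open Triple a≢b a≢c b≢c
    ballot : Bool → Bool → Pref A
    ballot true  true  = ranked 0 1 2
    ballot true  false = ranked 1 2 0
    ballot false _     = ranked 2 0 1
    P : Config A (Fin m)
    P t = ballot (Γ t) (H t)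
    ballot-ab : ∀ g h → comparison (ballot g h) a b ≡ orient g
    ballot-ab true  true  = ranked-ab
    ballot-ab true  false = ranked-ab
    ballot-ab false _     = ranked-ab
    ballot-ac : ∀ g h → comparison (ballot g h) a c ≡ orient (g ∧ h)
    ballot-ac true  true  = ranked-ac
    ballot-ac true  false = ranked-ac
    ballot-ac false _     = ranked-ac
    ballot-cb : ∀ g h → comparison (ballot g h) c b ≡ orient (g ∧ not h)
    ballot-cb true  true  = ranked-cb
    ballot-cb true  false = ranked-cb
    ballot-cb false _     = ranked-cb
    by-c≤a : Decisive a c (Γ ∩ H) ⊎ Decisive c b (Γ ∩ ∁ H)
    by-c≤a with rel (G P) c a in c≤a
    ... | false = inj₁ (<⇒decisive a≢c (λ t → ballot-ac (Γ t) (H t)) c≤a)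
    ... | true  = inj₂ (<⇒decisive (≢-sym b≢c) (λ t → ballot-cb (Γ t) (H t))
                         (≤-<-trans (G P) c≤a (decisive⇒< a≢b (λ t → ballot-ab (Γ t) (H t)) a<b)))

  ¬decisive-nobody : ¬ Decisive x y nobody
  ¬decisive-nobody x<y = decisive-proper x≢y x<y (pareto (≢-sym x≢y))

  decisive-split-xy : ∀ {Γ} H → Decisive x y Γ → Decisive x y (Γ ∩ H) ⊎ Decisive x y (Γ ∩ ∁ H)
  decisive-split-xy H x<y with third x y
  ... | z , z≢x , z≢y = Sum.map (decisive-transport (≢-sym z≢x) x≢y) (decisive-transport z≢y x≢y)
    (decisive-split H x≢y (≢-sym z≢x) (≢-sym z≢y) x<y)

  decisive-voter : ∃ λ t → Decisive x y ⁅ t ⁆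
  decisive-voter = principal m (Decisive x y) (decisive-mono x≢y) decisive-split-xy
    (pareto x≢y) ¬decisive-nobody

  Pivotal : Fin m → Set
  Pivotal t = ∀ {Γ a b} → Γ t ≡ true → a ≢ b → Decisive a b Γ

  pivotal-voter : ∃ Pivotal
  pivotal-voter with decisive-voter
  ... | t , decisive-t = t , λ Γ∋t a≢b → decisive-transport x≢y a≢b (decisive-mono x≢y (⁅⁆⊆ Γ∋t) decisive-t)

  pivotal⇒strict : ∀ {t} → Pivotal t → ∀ R {a b} → a ≢ b → a <⟨ R t ⟩ b → a <⟨ G R ⟩ b
  pivotal⇒strict {t} pivotal R {a} {b} a≢b a<b with third a b
  ... | c , c≢a , c≢b =
    iia-< R P (λ s → sym (ballot-ab (comparison (R s) a b) (complete (R s) a b)))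
      (<-trans (G P)
        (decisive⇒< {Γ = ac} (≢-sym c≢a) (λ s → ballot-ac (comparison (R s) a b)) (pivotal t∈ac (≢-sym c≢a)))
        (decisive⇒< {Γ = cb} c≢b (λ s → ballot-cb (comparison (R s) a b)) (pivotal t∈cb c≢b)))
    where
    open Between a≢b c≢a c≢b
    P : Config A (Fin m)
    P s = ballot (comparison (R s) a b)
    ac cb : Coalition m
    ac s = ac-below (comparison (R s) a b)
    cb s = cb-below (comparison (R s) a b)
    t∈ac : ac t ≡ true
    t∈ac = cong ac-below (comparison-below (R t) a<b)
    t∈cb : cb t ≡ true
    t∈cb = cong cb-below (comparison-below (R t) a<b)

  dictatorship : ∃ λ t → ∀ R a b → a ≤⟨ G R ⟩ b → a ≤⟨ R t ⟩ b
  dictatorship = proj₁ pivotal-voter , strict⇒dictator _≟_ G (pivotal⇒strict (proj₂ pivotal-voter))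

rev : Pref S → Pref S
rev P = record
  { rel      = λ x y → rel P y x
  ; complete = λ x y → complete P y x
  ; trans    = λ x y z x≥y y≥z → trans P z y x y≥z x≥y
  }

rev-iia : {f : SWF S V} → IIA f → IIA (rev ∘ f)
rev-iia iia P Q x y same = swap (iia P Q x y same)

coincideˡ : (T T' : Pref S) {a b c : S} → a ≤⟨ T ⟩ c → c ≤⟨ T' ⟩ a →
  comparison T a b ≡ comparison T' a b → comparison T c b ≡ comparison T' c b →
  comparison T a b ≡ comparison T c b
coincideˡ T T' {a} {b} {c} a≤c c≤a ab cb = ×-≡,≡→≡ (⇔→≡ (mk⇔ a≤b⇒c≤b c≤b⇒a≤b) , ⇔→≡ (mk⇔ b≤a⇒b≤c b≤c⇒b≤a))
  where
  a≤b⇒c≤b : a ≤⟨ T ⟩ b → c ≤⟨ T ⟩ b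
  a≤b⇒c≤b a≤b = ≡-trans (cong proj₁ cb) (trans T' c a b c≤a (≡-trans (sym (cong proj₁ ab)) a≤b))
  c≤b⇒a≤b : c ≤⟨ T ⟩ b → a ≤⟨ T ⟩ b
  c≤b⇒a≤b = trans T a c b a≤c
  b≤a⇒b≤c : b ≤⟨ T ⟩ a → b ≤⟨ T ⟩ c
  b≤a⇒b≤c b≤a = trans T b a c b≤a a≤c
  b≤c⇒b≤a : b ≤⟨ T ⟩ c → b ≤⟨ T ⟩ a
  b≤c⇒b≤a b≤c = ≡-trans (cong proj₂ ab) (trans T' b c a (≡-trans (sym (cong proj₂ cb)) b≤c) c≤a)

coincideʳ : (T T' : Pref S) {a b c : S} → a ≤⟨ T ⟩ c → c ≤⟨ T' ⟩ a →
  comparison T b a ≡ comparison T' b a → comparison T b c ≡ comparison T' b c →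
  comparison T b a ≡ comparison T b c
coincideʳ T T' {a} {b} {c} a≤c c≤a ba bc =
  ≡-trans ba (≡-trans (coincideˡ (rev T') (rev T) {a} {b} {c} c≤a a≤c (sym ba) (sym bc)) (sym bc))

module Wilson {A : Set} (_≟_ : DecidableEquality A) (third : Third A) {x y : A} (x≢y : x ≢ y)
  {m : ℕ} (G : SWF A (Fin m)) (iia : IIA G)
  (attainable : ∀ a b → ∃ λ R → a ≤⟨ G R ⟩ b) where

  open Ballots _≟_
  open Transport _≟_ third
  open Independence {listens = id} {f = G} iia
  open ≡-Reasoning

  unanimous : A → A → Comparison
  unanimous a b = comparison (G (const (top b))) a b

  module Squeeze {a b c : A} (a≢c : a ≢ c) (a≢b : a ≢ b) (c≢b : c ≢ b) (R : Config A (Fin m)) where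
    open Triple a≢c a≢b c≢b

    raised lowered : Config A (Fin m)
    raised t  = ranked (encode (comparison (R t) a c)) 2 4
    lowered t = ranked (encode (comparison (R t) a c)) 2 0

    raised-ac : comparison (G raised) a c ≡ comparison (G R) a c
    raised-ac = iia-comparison raised R λ t → ≡-trans ranked-ab (ranks-encode _ (complete (R t) a c))

    raised-ab : comparison (G raised) a b ≡ unanimous a b
    raised-ab = iia-comparison raised (const (top b)) λ t →
      ≡-trans ranked-ac (≡-trans (ranks-encode-4 (comparison (R t) a c)) (sym (top-below a≢b)))

    raised-cb : comparison (G raised) c b ≡ unanimous c b
    raised-cb = iia-comparison raised (const (top b)) λ t → ≡-trans ranked-bc (sym (top-below c≢b))

    lowered-ac : comparison (G lowered) a c ≡ comparison (G R) a c
    lowered-ac = iia-comparison lowered R λ t → ≡-trans ranked-ab (ranks-encode _ (complete (R t) a c))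

    lowered-ba : comparison (G lowered) b a ≡ unanimous b a
    lowered-ba = iia-comparison lowered (const (top a)) λ t →
      ≡-trans ranked-ca (≡-trans (ranks-0-encode (comparison (R t) a c)) (sym (top-below (≢-sym a≢b))))

    lowered-bc : comparison (G lowered) b c ≡ unanimous b c
    lowered-bc = iia-comparison lowered (const (top c)) λ t → ≡-trans ranked-cb (sym (top-below (≢-sym c≢b)))

  unanimous-changeˡ : ∀ {a b c} → a ≢ b → c ≢ a → c ≢ b → unanimous a b ≡ unanimous c b
  unanimous-changeˡ {a} {b} {c} a≢b c≢a c≢b = begin
    unanimous a b               ≡⟨ sym S.raised-ab ⟩
    comparison (G S.raised) a b ≡⟨ coincideˡ (G S.raised) (G S'.raised) a≤c c≤a
                                     (≡-trans S.raised-ab (sym S'.raised-ab))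
                                     (≡-trans S.raised-cb (sym S'.raised-cb)) ⟩
    comparison (G S.raised) c b ≡⟨ S.raised-cb ⟩
    unanimous c b               ∎
    where
    module S  = Squeeze (≢-sym c≢a) a≢b c≢b (proj₁ (attainable a c))
    module S' = Squeeze (≢-sym c≢a) a≢b c≢b (proj₁ (attainable c a))
    a≤c : a ≤⟨ G S.raised ⟩ c
    a≤c = ≡-trans (cong proj₁ S.raised-ac) (proj₂ (attainable a c))
    c≤a : c ≤⟨ G S'.raised ⟩ a
    c≤a = ≡-trans (cong proj₂ S'.raised-ac) (proj₂ (attainable c a))

  unanimous-changeʳ : ∀ {a b d} → a ≢ b → a ≢ d → b ≢ d → unanimous a b ≡ unanimous a d
  unanimous-changeʳ {a} {b} {d} a≢b a≢d b≢d = begin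
    unanimous a b                ≡⟨ sym S.lowered-ba ⟩
    comparison (G S.lowered) a b ≡⟨ coincideʳ (G S.lowered) (G S'.lowered) b≤d d≤b
                                      (≡-trans S.lowered-ba (sym S'.lowered-ba))
                                      (≡-trans S.lowered-bc (sym S'.lowered-bc)) ⟩
    comparison (G S.lowered) a d ≡⟨ S.lowered-bc ⟩
    unanimous a d                ∎
    where
    module S  = Squeeze b≢d (≢-sym a≢b) (≢-sym a≢d) (proj₁ (attainable b d))
    module S' = Squeeze b≢d (≢-sym a≢b) (≢-sym a≢d) (proj₁ (attainable d b))
    b≤d : b ≤⟨ G S.lowered ⟩ d
    b≤d = ≡-trans (cong proj₁ S.lowered-ac) (proj₂ (attainable b d))
    d≤b : d ≤⟨ G S'.lowered ⟩ b
    d≤b = ≡-trans (cong proj₂ S'.lowered-ac) (proj₂ (attainable d b))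

  neutral : ∀ {a b} → a ≢ b → unanimous a b ≡ unanimous x y
  neutral a≢b = transport (λ a b → unanimous a b ≡ unanimous x y)
    (λ a≢b a≢d b≢d → ≡-trans (sym (unanimous-changeʳ a≢b a≢d b≢d)))
    (λ a≢b c≢a c≢b → ≡-trans (sym (unanimous-changeˡ a≢b c≢a c≢b)))
    x≢y a≢b refl

  tie⇒null : unanimous x y ≡ (true , true) → Null G
  tie⇒null tie R a c with a ≟ c
  ... | yes refl = ≤-refl (G R) a , ≤-refl (G R) a
  ... | no a≢c with third a c
  ...   | b , b≢a , b≢c =
    ≡-trans (sym (cong proj₁ raised-ac)) (trans (G raised) a b c (cong proj₁ ab) (cong proj₂ cb)) ,
    ≡-trans (sym (cong proj₂ raised-ac)) (trans (G raised) c b a (cong proj₁ cb) (cong proj₂ ab))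
    where
    open Squeeze a≢c (≢-sym b≢a) (≢-sym b≢c) R
    ab : comparison (G raised) a b ≡ (true , true)
    ab = ≡-trans raised-ab (≡-trans (neutral (≢-sym b≢a)) tie)
    cb : comparison (G raised) c b ≡ (true , true)
    cb = ≡-trans raised-cb (≡-trans (neutral (≢-sym b≢c)) tie)

  below⇒pareto : unanimous x y ≡ below → ∀ {a b} → a ≢ b → a <⟨ G (const (top b)) ⟩ b
  below⇒pareto u a≢b = cong proj₂ (≡-trans (neutral a≢b) u)

  above⇒reverse-pareto : unanimous x y ≡ above → ∀ {a b} → a ≢ b → a <⟨ rev (G (const (top b))) ⟩ b
  above⇒reverse-pareto u a≢b = cong proj₁ (≡-trans (neutral a≢b) u)

  wilson : Null G ⊎ ∃ (Dictator G)
  wilson with unanimous x y in u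
  ... | true  , true  = inj₁ (tie⇒null u)
  ... | true  , false = inj₂ (map₂ inj₁ (Arrow.dictatorship _≟_ third x≢y G iia (below⇒pareto u)))
  ... | false , true  = inj₂ (map₂ (λ d → inj₂ λ R a b → d R b a)
                                   (Arrow.dictatorship _≟_ third x≢y (rev ∘ G) (rev-iia {f = G} iia)
                                                       (above⇒reverse-pareto u)))
  ... | false , false = ⊥-elim (invalid (subst Valid u (comparison-valid (G (const (top y))) x y)))

record Finite (S : Set) : Set where
  field
    _≟_             : DecidableEquality S
    size            : ℕ
    enum            : Fin size → S
    enum-surjective : ∀ s → ∃ λ t → enum t ≡ s

module _ {S : Set} (FS : Finite S) where
  open Finite FS

  search : {P : S → Set} → Decidable P → (∀ s → ¬ P s) ⊎ ∃ P
  search {P} P? with any? (P? ∘ enum)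
  ... | yes (t , p) = inj₂ (enum t , p)
  ... | no none     = inj₁ λ s p → let t , enum-t = enum-surjective s in none (t , subst P (sym enum-t) p)

  others : (a : S) → (∀ s → s ≡ a) ⊎ ∃ (_≢ a)
  others a = Sum.map₁ (λ none s → decidable-stable (s ≟ a) (none s)) (search (λ s → ¬? (s ≟ a)))

  others₂ : (a b : S) → (∀ s → s ≡ a ⊎ s ≡ b) ⊎ ∃ λ c → c ≢ a × c ≢ b
  others₂ a b = Sum.map₁ (λ none s → one-of s (none s)) (search (λ s → ¬? (s ≟ a) ×-dec ¬? (s ≟ b)))
    where
    one-of : ∀ s → ¬ (s ≢ a × s ≢ b) → s ≡ a ⊎ s ≡ b
    one-of s neither with s ≟ a | s ≟ b
    ... | yes s≡a | _       = inj₁ s≡a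
    ... | no _    | yes s≡b = inj₂ s≡b
    ... | no s≢a  | no s≢b  = ⊥-elim (neither (s≢a , s≢b))

-- Elements of V ∖ i carry proofs of k ≢ i, which cannot be identified without function
-- extensionality, so V ∖ i is not presented as a Fin. Instead a roster lists finitely many
-- voters, and the induction keeps the invariant that f only listens to them (IIAOn).
record Roster (W : Set) (m : ℕ) : Set where
  field
    voter      : Fin m → W
    seat       : W → Maybe (Fin m)
    seat-voter : ∀ t → seat (voter t) ≡ just t

module Rostered {S W : Set} {m : ℕ} (E : Roster W m) where
  open Roster E

  fill : (Fin m → Pref S) → Config S W
  fill q w = maybe′ q indifference (seat w)

  fill-voter : ∀ q t → fill q (voter t) ≡ q t
  fill-voter q t rewrite seat-voter t = refl

  module Listening {f : SWF S W} (iia : IIAOn voter f) where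

    lower-iia : IIA (f ∘ fill)
    lower-iia P Q x y same = iia (fill P) (fill Q) x y λ t →
      subst₂ (λ R R' → AgreeOn R R' x y) (sym (fill-voter P t)) (sym (fill-voter Q t)) (same t)

    fill-roster : ∀ Q {x y} → comparison (f Q) x y ≡ comparison (f (fill (Q ∘ voter))) x y
    fill-roster Q {x} {y} = Independence.iia-comparison {f = f} iia Q (fill (Q ∘ voter)) λ t →
      cong (λ R → comparison R x y) (sym (fill-voter (Q ∘ voter) t))

    null-lift : Null (f ∘ fill) → Null f
    null-lift null Q x y with null (Q ∘ voter) x y
    ... | x≤y , y≤x = ≡-trans (cong proj₁ (fill-roster Q)) x≤y , ≡-trans (cong proj₂ (fill-roster Q)) y≤x

    dictator-lift : ∀ {t} → Dictator (f ∘ fill) t → Dictator f (voter t)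
    dictator-lift (inj₁ d) = inj₁ λ Q x y → d (Q ∘ voter) x y ∘ ≡-trans (sym (cong proj₁ (fill-roster Q)))
    dictator-lift (inj₂ d) = inj₂ λ Q x y → d (Q ∘ voter) x y ∘ ≡-trans (sym (cong proj₁ (fill-roster Q)))

-- The cleric and its classes

module Cleric {S W : Set} (_≟_ : DecidableEquality S) {m : ℕ} (E : Roster W m)
  (f : SWF S W) (iia : IIAOn (Roster.voter E) f) where

  open Roster E
  open Rostered {S = S} E
  open Ballots _≟_
  open Independence {f = f} iia

  Attainable : S → S → Set
  Attainable a b = ∃ λ R → a ≤⟨ f R ⟩ b

  -- by independence only the voters' comparisons of a and b matter, and there are finitely many
  attainable? : ∀ a b → Dec (Attainable a b)
  attainable? a b with a ≟ b
  ... | yes refl = yes (const indifference , ≤-refl (f (const indifference)) a)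
  ... | no a≢b = map′ realise by-comparisons (∃-comparisons? m resp λ q → rel (f (placing q)) a b Bool.≟ true)
    where
    placing : (Fin m → Comparison) → Config S W
    placing q = fill (placed a ∘ q)
    placing-comparison : ∀ q t → comparison (placing q (voter t)) a b ≡ comparison (placed a (q t)) a b
    placing-comparison q t = cong (λ R → comparison R a b) (fill-voter (placed a ∘ q) t)
    resp : ∀ {q q'} → (∀ t → q t ≡ q' t) → a ≤⟨ f (placing q) ⟩ b → a ≤⟨ f (placing q') ⟩ b
    resp {q} {q'} q≗q' = iia-≤ (placing q') (placing q) λ t →
      ≡-trans (placing-comparison q' t) (≡-trans (cong (λ p → comparison (placed a p) a b) (sym (q≗q' t)))
                                                 (sym (placing-comparison q t)))
    realise : ∃ (λ q → a ≤⟨ f (placing q) ⟩ b) → Attainable a b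
    realise (q , a≤b) = placing q , a≤b
    by-comparisons : Attainable a b → ∃ (λ q → a ≤⟨ f (placing q) ⟩ b)
    by-comparisons (R , a≤b) = q , iia-≤ (placing q) R (λ t →
        ≡-trans (placing-comparison q t) (placed-comparison a≢b (comparison-valid (R (voter t)) a b))) a≤b
      where
      q : Fin m → Comparison
      q t = comparison (R (voter t)) a b

  attainable-trans : ∀ {a b c} → Attainable a b → Attainable b c → Attainable a c
  attainable-trans {a} {b} {c} (R₁ , a≤b) (R₂ , b≤c) with a ≟ b | b ≟ c | a ≟ c
  ... | yes refl | _        | _        = R₂ , b≤c
  ... | no _     | yes refl | _        = R₁ , a≤b
  ... | no _     | no _     | yes refl = R₁ , ≤-refl (f R₁) a
  ... | no a≢b   | no b≢c   | no a≢c   =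
    R , trans (f R) a b c
          (iia-≤ R R₁ (λ t → ≡-trans ranked-ab (ranks-encode _ (comparison-valid (R₁ (voter t)) a b))) a≤b)
          (iia-≤ R R₂ (λ t → ≡-trans ranked-bc (cong swap (ranks-encode _ (comparison-valid (R₂ (voter t)) c b))))
                 b≤c)
    where
    open Triple a≢b a≢c b≢c
    R : Config S W
    R w = ranked (encode (comparison (R₁ w) a b)) 2 (encode (comparison (R₂ w) c b))

  attainable : ∀ {a b} → does (attainable? a b) ≡ true → Attainable a b
  attainable {a} {b} _ with attainable? a b
  attainable _ | yes a⇝b = a⇝b

  cleric : Pref S
  cleric = record
    { rel      = λ a b → does (attainable? a b)
    ; complete = λ a b → Sum.map (dec-true (attainable? a b) ∘ (const indifference ,_))
                                 (dec-true (attainable? b a) ∘ (const indifference ,_))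
                                 (complete (f (const indifference)) a b)
    ; trans    = λ a b c a⇝b b⇝c →
                   dec-true (attainable? a c) (attainable-trans (attainable a⇝b) (attainable b⇝c))
    }

  clerical : Clerical f cleric
  clerical R a b a≤b = dec-true (attainable? a b) (R , a≤b)

module ClassOf {S W : Set} (FS : Finite S) {m : ℕ} (E : Roster W m)
  (f : SWF S W) (iia : IIAOn (Roster.voter E) f) (x : S) where

  open Finite FS
  open Roster E
  open Cleric _≟_ E f iia
  open Independence {f = f} iia

  InA : S → Set
  InA y = x ≈⟨ cleric ⟩ y

  A : Set
  A = Class cleric x

  open Rostered {S = A} E

  centre : A
  centre = x , ≤-refl cleric x , ≤-refl cleric x

  InA? : Decidable InA
  InA? y = (rel cleric x y Bool.≟ true) ×-dec (rel cleric y x Bool.≟ true)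

  InA-irrelevant : ∀ {y} (p q : InA y) → p ≡ q
  InA-irrelevant (p₁ , p₂) (q₁ , q₂) = cong₂ _,_ (Bool-UIP p₁ q₁) (Bool-UIP p₂ q₂)
    where open Decidable⇒UIP Bool._≟_ renaming (≡-irrelevant to Bool-UIP)

  retract : S → A
  retract y with InA? y
  ... | yes y∈A = y , y∈A
  ... | no  _   = centre

  retract-id : ∀ a → retract (proj₁ a) ≡ a
  retract-id (y , y∈A) with InA? y
  ... | yes y∈A' = cong (y ,_) (InA-irrelevant y∈A' y∈A)
  ... | no  y∉A  = ⊥-elim (y∉A y∈A)

  _≟A_ : DecidableEquality A
  (y , p) ≟A (y' , p') with y ≟ y'
  ... | yes refl = yes (cong (y ,_) (InA-irrelevant p p'))
  ... | no y≢y'  = no (y≢y' ∘ cong proj₁)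

  finite : Finite A
  finite = record
    { _≟_             = _≟A_
    ; size            = size
    ; enum            = retract ∘ enum
    ; enum-surjective = λ a → let t , enum-t = enum-surjective (proj₁ a) in
                              t , ≡-trans (cong retract enum-t) (retract-id a)
    }

  g : SWF A W
  g Q = restrictPref InA (f (comap retract ∘ Q))

  comap-retract : ∀ P (a b : A) → comparison (comap retract P) (proj₁ a) (proj₁ b) ≡ comparison P a b
  comap-retract P a b = cong₂ (comparison P) (retract-id a) (retract-id b)

  restricts : RestrictsTo f cleric x g
  restricts R a b = cong proj₁ (iia-comparison R (comap retract ∘ restrictPref InA ∘ R) λ t →
    sym (comap-retract (restrictPref InA (R (voter t))) a b))

  g-iia : IIAOn voter g
  g-iia P Q a b same = iia (comap retract ∘ P) (comap retract ∘ Q) (proj₁ a) (proj₁ b) λ t →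
    ×-≡,≡←≡ (≡-trans (comap-retract (P (voter t)) a b)
              (≡-trans (×-≡,≡→≡ (same t)) (sym (comap-retract (Q (voter t)) a b))))

  g-attainable : ∀ a b → ∃ λ Q → a ≤⟨ g Q ⟩ b
  g-attainable a b with attainable (trans cleric (proj₁ a) x (proj₁ b) (proj₂ (proj₂ a)) (proj₁ (proj₂ b)))
  ... | R , a≤b = restrictPref InA ∘ R , ≡-trans (sym (restricts R a b)) a≤b

  open Listening {f = g} g-iia

  shape : Null g ⊎ Dictatorial g ⊎ ExactlyTwo A
  shape with others finite centre
  ... | inj₁ all-centre = inj₁ (subsingleton-null (λ a b → ≡-trans (all-centre a) (sym (all-centre b))) g)
  ... | inj₂ (b , b≢centre) with others₂ finite centre b
  ...   | inj₁ two = inj₂ (inj₂ (centre , b , ≢-sym b≢centre , two))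
  ...   | inj₂ (c , c≢centre , c≢b) =
    Sum.map null-lift (λ (t , d) → inj₁ (voter t , dictator-lift d))
      (Wilson.wilson _≟A_ (third _≟A_ (≢-sym b≢centre) (≢-sym c≢centre) (≢-sym c≢b)) (≢-sym b≢centre)
        (g ∘ fill) lower-iia G-attainable)
    where
    G-attainable : ∀ a b → ∃ λ q → a ≤⟨ g (fill q) ⟩ b
    G-attainable a b with g-attainable a b
    ... | Q , a≤b = Q ∘ voter , ≡-trans (sym (cong proj₁ (fill-roster Q {a} {b}))) a≤b

-- Dictators and deferral

module Dictated {A W : Set} (_≟_ : DecidableEquality A) {m : ℕ} (E : Roster W m)
  (g : SWF A W) (iia : IIAOn (Roster.voter E) g) {j : W} (dictator : Dictator g j) where

  open Roster E
  open Ballots _≟_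

  dictator-heard : ∀ (Q₁ Q₂ : Config A W) {a b} → (∀ t → AgreeOn (Q₁ (voter t)) (Q₂ (voter t)) a b) →
    a <⟨ Q₁ j ⟩ b → b <⟨ Q₂ j ⟩ a → ⊥
  dictator-heard Q₁ Q₂ {a} {b} same a<b b<a = heard dictator (complete (g Q₁) a b) (iia Q₁ Q₂ a b same)
    where
    heard : Dictator g j → a ≤⟨ g Q₁ ⟩ b ⊎ b ≤⟨ g Q₁ ⟩ a → AgreeOn (g Q₁) (g Q₂) a b → ⊥
    heard (inj₁ d) (inj₁ a≤b) (ab , _) = <⇒≱ (Q₂ j) b<a (d Q₂ a b (≡-trans (sym ab) a≤b))
    heard (inj₁ d) (inj₂ b≤a) _        = <⇒≱ (Q₁ j) a<b (d Q₁ b a b≤a)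
    heard (inj₂ d) (inj₁ a≤b) _        = <⇒≱ (Q₁ j) a<b (d Q₁ a b a≤b)
    heard (inj₂ d) (inj₂ b≤a) (_ , ba) = <⇒≱ (Q₂ j) b<a (d Q₂ b a (≡-trans (sym ba) b≤a))

  seated : ∀ {a b} → a ≢ b → ∃ λ t → seat j ≡ just t
  seated {a} {b} a≢b with seat j in seat-j
  ... | just t  = t , refl
  ... | nothing = ⊥-elim (dictator-heard (const (top b)) off-roster on-roster (cong proj₂ (top-below a≢b)) b<a)
    where
    off-roster : Config A W
    off-roster w = maybe′ (const (top b)) (top a) (seat w)
    on-roster : ∀ t → AgreeOn (top b) (off-roster (voter t)) a b
    on-roster t rewrite seat-voter t = refl , refl
    b<a : b <⟨ off-roster j ⟩ a
    b<a rewrite seat-j = cong proj₂ (top-below (≢-sym a≢b))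

  -- j itself may differ from voter t₀ (seats need not be injective), and g only listens to voter t₀
  same-view : ∀ {t₀} → seat j ≡ just t₀ →
    ∀ (Q : Config A W) a b → comparison (Q j) a b ≡ comparison (Q (voter t₀)) a b
  same-view {t₀} seat-j Q a b with a ≟ b
  ... | yes refl = cong₂ _,_ (≡-trans (≤-refl (Q j) a) (sym (≤-refl (Q (voter t₀)) a)))
                             (≡-trans (≤-refl (Q j) a) (sym (≤-refl (Q (voter t₀)) a)))
  ... | no a≢b with comparison (Q j) a b ≟C comparison (Q (voter t₀)) a b
  ...   | yes same = same
  ...   | no differ =
    ⊥-elim (dictator-heard Q₁ Q₂ unmarked-agree (marked-j-top b a≢b) (marked-j-top a (≢-sym a≢b)))
    where
    at-seat : Maybe (Fin m) → Bool
    at-seat (just t) = does (t ≟F t₀)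
    at-seat nothing  = false
    marked : W → Bool
    marked w = at-seat (seat w) ∧ does (comparison (Q w) a b ≟C comparison (Q j) a b)
    mark : A → Config A W
    mark c w = if marked w then top c else indifference
    Q₁ Q₂ : Config A W
    Q₁ = mark b
    Q₂ = mark a
    unmarked : ∀ t → marked (voter t) ≡ false
    unmarked t rewrite seat-voter t with t ≟F t₀
    ... | no _     = refl
    ... | yes refl = dec-false (comparison (Q (voter t₀)) a b ≟C comparison (Q j) a b) (differ ∘ sym)
    unmarked-agree : ∀ t → AgreeOn (Q₁ (voter t)) (Q₂ (voter t)) a b
    unmarked-agree t rewrite unmarked t = refl , refl
    marked-j : marked j ≡ true
    marked-j = ≡-trans (cong (λ s → at-seat s ∧ does (comparison (Q j) a b ≟C comparison (Q j) a b)) seat-j)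
                       (cong₂ _∧_ (dec-true (t₀ ≟F t₀) refl)
                                  (dec-true (comparison (Q j) a b ≟C comparison (Q j) a b) refl))
    marked-j-top : ∀ c {d} → d ≢ c → d <⟨ mark c j ⟩ c
    marked-j-top c d≢c rewrite marked-j = cong proj₂ (top-below d≢c)

module Reduction {W : Set} {m : ℕ} (E : Roster W (suc m)) {j : W} {t₀ : Fin (suc m)}
  (seat-j : Roster.seat E j ≡ just t₀) where

  open Roster E

  voter≢j : ∀ s → voter (punchIn t₀ s) ≢ j
  voter≢j s voter≡j = punchInᵢ≢i t₀ s (just-injective (≡-trans (sym (seat-voter (punchIn t₀ s)))
                                                               (≡-trans (cong seat voter≡j) seat-j)))

  unpunch : Fin (suc m) → Maybe (Fin m)
  unpunch t with t₀ ≟F t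
  ... | yes _    = nothing
  ... | no t₀≢t = just (punchOut t₀≢t)

  unpunch-punchIn : ∀ s → unpunch (punchIn t₀ s) ≡ just s
  unpunch-punchIn s with t₀ ≟F punchIn t₀ s
  ... | yes t₀≡ = ⊥-elim (punchInᵢ≢i t₀ s (sym t₀≡))
  ... | no _    = cong just (≡-trans (punchOut-cong t₀ refl) (punchOut-punchIn t₀))

  roster : Roster (W ∖ j) m
  roster = record
    { voter      = λ s → voter (punchIn t₀ s) , voter≢j s
    ; seat       = λ w → maybe′ unpunch nothing (seat (proj₁ w))
    ; seat-voter = λ s → ≡-trans (cong (maybe′ unpunch nothing) (seat-voter (punchIn t₀ s))) (unpunch-punchIn s)
    }

  extend : {A : Set} → Config A (W ∖ j) → Fin (suc m) → Pref A
  extend Q t with t₀ ≟F t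
  ... | yes _    = indifference
  ... | no t₀≢t = Q (Roster.voter roster (punchOut t₀≢t))

  module _ {A : Set} (g : SWF A W) (iia : IIAOn voter g) where
    open Rostered {S = A} E
    open Listening {f = g} iia

    h : SWF A (W ∖ j)
    h Q = g (fill (extend Q))

    h-iia : IIAOn (Roster.voter roster) h
    h-iia P Q a b same = lower-iia (extend P) (extend Q) a b extended
      where
      extended : ∀ t → AgreeOn (extend P t) (extend Q t) a b
      extended t with t₀ ≟F t
      ... | yes _    = refl , refl
      ... | no t₀≢t = same (punchOut t₀≢t)

    defers : (∀ (Q : Config A W) a b → comparison (Q j) a b ≡ comparison (Q (voter t₀)) a b) → Defers g j h
    defers same-view R a b (a≤b , b≤a) = cong proj₁
      (Independence.iia-comparison {f = g} iia R (fill (extend (drop R j))) λ t →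
        ≡-trans (voter-view t) (cong (λ P → comparison P a b) (sym (fill-voter (extend (drop R j)) t))))
      where
      voter-view : ∀ t → comparison (R (voter t)) a b ≡ comparison (extend (drop R j) t) a b
      voter-view t with t₀ ≟F t
      ... | yes refl = ≡-trans (sym (same-view R a b)) (cong₂ _,_ a≤b b≤a)
      ... | no t₀≢t = cong (λ s → comparison (R (voter s)) a b) (sym (punchIn-punchOut t₀≢t))

-- The induction, on the size of the roster

Theorem : ℕ → Set₁
Theorem m = ∀ {S W : Set} → Finite S → (E : Roster W m) (f : SWF S W) → IIAOn (Roster.voter E) f →
  ClericalDictatorial S W f

TheoremBelow : ℕ → Set₁
TheoremBelow zero    = ⊤
TheoremBelow (suc m) = Theorem m

Deferral : (A W : Set) → SWF A W → W → Set₁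
Deferral A W g j = Σ (SWF A (W ∖ j)) λ h → Defers g j h × ClericalDictatorial A (W ∖ j) h

subsingleton-deferral : {A W : Set} → (∀ (a b : A) → a ≡ b) → (g : SWF A W) (j : W) → Deferral A W g j
subsingleton-deferral all-equal g j =
  const indifference ,
  (λ R a b _ → proj₁ (subsingleton-null all-equal g R a b)) ,
  cd-null (subsingleton-null all-equal (const indifference))

seated-deferral : ∀ {m} → TheoremBelow m → {A W : Set} → Finite A → (E : Roster W m) (g : SWF A W) →
  (iia : IIAOn (Roster.voter E) g) → ∀ {j} → (dictator : Dictator g j) → ∃ (λ t → Roster.seat E j ≡ just t) →
  Deferral A W g j
seated-deferral {zero}  _       FA E g iia dictator (() , _)
seated-deferral {suc m} theorem FA E g iia dictator (t₀ , seat-j) =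
  h g iia , defers g iia (Dictated.same-view (Finite._≟_ FA) E g iia dictator seat-j) ,
  theorem FA roster (h g iia) (h-iia g iia)
  where open Reduction E seat-j

deferral : ∀ {m} → TheoremBelow m → {A W : Set} → Finite A → A → (E : Roster W m) (g : SWF A W) →
  IIAOn (Roster.voter E) g → ∀ j → Dictator g j → Deferral A W g j
deferral previous FA a₀ E g iia j dictator with others FA a₀
... | inj₁ all-a₀      = subsingleton-deferral (λ a b → ≡-trans (all-a₀ a) (sym (all-a₀ b))) g j
... | inj₂ (b , b≢a₀) = seated-deferral previous FA E g iia dictator
                            (Dictated.seated (Finite._≟_ FA) E g iia dictator b≢a₀)

clerical-dictatorial-step : ∀ {m} → TheoremBelow m → Theorem m
clerical-dictatorial-step previous FS E f iia = cd-cleric cleric clerical λ x →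
  let open ClassOf FS E f iia x in
  g , restricts , shape , deferral previous finite centre E g g-iia
  where open Cleric (Finite._≟_ FS) E f iia

clerical-dictatorial : ∀ m → Theorem m
clerical-dictatorial zero    = clerical-dictatorial-step {zero} tt
clerical-dictatorial (suc m) = clerical-dictatorial-step {suc m} (clerical-dictatorial m)

finite-Fin : ∀ n → Finite (Fin n)
finite-Fin n = record { _≟_ = _≟F_ ; size = n ; enum = id ; enum-surjective = λ s → s , refl }

roster-Fin : ∀ N → Roster (Fin N) N
roster-Fin N = record { voter = id ; seat = just ; seat-voter = λ _ → refl }

theorem7 : (n N : ℕ) (f : SWF (Fin n) (Fin N)) → IIA f → ClericalDictatorial (Fin n) (Fin N) f
theorem7 n N = clerical-dictatorial N (finite-Fin n) (roster-Fin N)
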